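{- Let $G$ be a graph, $E_1\subseteq E(G)$, and $L$ a list assignment for $G$. Let $v\in V(G)$ and $E_1' = E_1\setminus\delta(v)$. Suppose $\phi$ is an $E_1'$-acyclic $L$-colouring of $G\setminus\{v\}$. Let $S\subseteq N_{E_1}(v)$ be such that for every pair of distinct vertices $u_1,u_2\in N_{E_1}(v)$ with $\phi(u_1)=\phi(u_2)$ we have $S\cap\{u_1,u_2\}\neq\emptyset$. Let $N_S:=\bigcup_{u\in S}(N_{E_1}(u)\setminus\{v\})$. If $L(v)\setminus(\phi(N(v))\cup\phi(N_S))$ is non-empty, then $\phi$ extends to an $E_1$-acyclic $L$-colouring of $G$, i.e. there is an $E_1$-acyclic $L$-colouring of $G$ agreeing with $\phi$ on $V(G)\setminus\{v\}$.
   Context: Graphs are finite and simple. $\delta(v)$ is the set of edges incident with $v$; $N_{E_1}(u)=\{x\in N(u): ux\in E_1\}$; for a set $X$ of vertices, $\phi(X)=\{\phi(x):x\in X\}$. A list assignment $L$ gives each vertex a set $L(x)$ of colours. For $F\subseteq E(H)$, an $F$-cycle of $H$ is a cycle all of whose edges lie in $F$; an $F$-acyclic $L$-colouring of $H$ is a proper colouring $\varphi$ with $\varphi(x)\in L(x)$ for all $x$ such that no $F$-cycle $C$ has $|\varphi(V(C))|=2$. -}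

module Defs where

open import Data.Nat using (ℕ; suc)
open import Data.Fin using (Fin; zero; suc; inject₁; fromℕ; _≟_)
open import Data.Bool using (Bool; true; false; T; _∧_; not)
open import Data.Product using (Σ; _×_; ∃; ∃-syntax; _,_)
open import Data.Unit using (⊤)
open import Data.Sum using (_⊎_)
open import Relation.Nullary using (¬_)
open import Relation.Nullary.Decidable using (⌊_⌋)
open import Relation.Binary.PropositionalEquality using (_≡_; _≢_; subst) renaming (sym to sym≡)
open import Function.Definitions using (Injective)

record Graph : Set where
  field
    n     : ℕ
    adj   : Fin n → Fin n → Bool
    sym   : ∀ x y → T (adj x y) → T (adj y x)
    loopless : ∀ x → ¬ T (adj x x)

open Graph public

V : Graph → Set
V G = Fin (n G)

Adj : (G : Graph) → V G → V G → Set
Adj G x y = T (adj G x y)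

record EdgeSet (G : Graph) : Set₁ where
  field
    mem  : V G → V G → Set
    symE : ∀ x y → mem x y → mem y x
    sub  : ∀ x y → mem x y → Adj G x y

open EdgeSet public

removeδ : (G : Graph) → EdgeSet G → V G → EdgeSet G
removeδ G F v = record
  { mem  = λ x y → mem F x y × x ≢ v × y ≢ v
  ; symE = λ { x y (e , p , q) → symE F x y e , q , p }
  ; sub  = λ { x y (e , _ , _) → sub F x y e } }

-- An F-cycle of G: distinct vertices c 0, …, c (k+2) (so length ≥ 3),
-- consecutive ones (cyclically) joined by edges of F.
record Cycle (G : Graph) (F : EdgeSet G) : Set where
  field
    k     : ℕ
    c     : Fin (suc (suc (suc k))) → V G
    inj   : Injective _≡_ _≡_ c
    edges : ∀ (i : Fin (suc (suc k))) → mem F (c (inject₁ i)) (c (suc i))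
    close : mem F (c (fromℕ (suc (suc k)))) (c zero)

open Cycle public

TwoColoured : {G : Graph} {F : EdgeSet G} → Cycle G F → (V G → ℕ) → Set
TwoColoured C φ =
  Σ ℕ λ a → Σ ℕ λ b → a ≢ b
    × (∀ i → φ (c C i) ≡ a ⊎ φ (c C i) ≡ b)
    × (∃[ i ] φ (c C i) ≡ a) × (∃[ j ] φ (c C j) ≡ b)

-- An F-acyclic L-colouring of the induced subgraph G[X] (X a set of vertices).
-- Colours are natural numbers; φ is only constrained on X.
AcyclicLColouringOn : (G : Graph) (X : V G → Set) (F : EdgeSet G)
  (L : V G → ℕ → Set) (φ : V G → ℕ) → Set
AcyclicLColouringOn G X F L φ =
    (∀ x y → X x → X y → Adj G x y → φ x ≢ φ y)
  × (∀ x → X x → L x (φ x))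
  × (∀ (C : Cycle G F) → (∀ i → X (c C i)) → ¬ TwoColoured C φ)

AcyclicLColouring : (G : Graph) (F : EdgeSet G) (L : V G → ℕ → Set) (φ : V G → ℕ) → Set
AcyclicLColouring G F L φ = AcyclicLColouringOn G (λ _ → ⊤) F L φ

{-# OPTIONS --safe #-}
-- Recolour v with the free colour col; the choice of col keeps the colouring proper and
-- within the lists. A two-coloured E₁-cycle avoiding v would already be a two-coloured
-- E₁′-cycle under φ. On a two-coloured cycle through v the colours alternate, so the two
-- cycle-neighbours of v have the same colour and one of them, u, lies in S; the vertex two
-- steps beyond v on u's side is then an E₁-neighbour of u, distinct from v because cycles
-- have at least three vertices, and coloured like v, i.e. with col, which col avoids.
module Submission where

open import Defs hiding (sym)
open import Data.Nat using (ℕ; suc)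
open import Data.Fin using (Fin; zero; suc; inject₁; fromℕ; _≟_)
open import Data.Fin.Properties using (any?; suc-injective; 0≢1+n)
open import Data.Fin.Relation.Unary.Top using (View; view; ‵fromℕ; ‵inject₁; view-fromℕ; view-inject₁)
open import Data.Vec.Functional using (updateAt)
open import Data.Vec.Functional.Properties using (updateAt-updates; updateAt-minimal)
open import Data.Product using (Σ; _×_; _,_)
open import Data.Sum using (_⊎_; inj₁; inj₂; [_,_]′; map)
open import Function using (_∘_; const)
open import Relation.Nullary using (¬_; yes; no; contradiction)
open import Relation.Binary.PropositionalEquality
  using (_≡_; _≢_; refl; sym; trans; cong; subst; ≢-sym; module ≡-Reasoning)

next : ∀ {m} → Fin (suc m) → Fin (suc m)
next i with view i
... | ‵fromℕ     = zero
... | ‵inject₁ j = suc j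

prev : ∀ {m} → Fin (suc m) → Fin (suc m)
prev {m} zero = fromℕ m
prev (suc i)  = inject₁ i

next-fromℕ : ∀ m → next (fromℕ m) ≡ zero
next-fromℕ m rewrite view-fromℕ m = refl

next-inject₁ : ∀ {m} (i : Fin m) → next (inject₁ i) ≡ suc i
next-inject₁ i rewrite view-inject₁ i = refl

next-prev : ∀ {m} (i : Fin (suc m)) → next (prev i) ≡ i
next-prev {m} zero = next-fromℕ m
next-prev (suc i)  = next-inject₁ i

suc²≢inject₁² : ∀ {m} (i : Fin m) → suc (suc i) ≢ inject₁ (inject₁ i)
suc²≢inject₁² zero    ()
suc²≢inject₁² (suc i) = suc²≢inject₁² i ∘ suc-injective

next∘suc≢inject₁ : ∀ {k} (i : Fin (suc (suc k))) → next (suc i) ≢ inject₁ i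
next∘suc≢inject₁ {k} i = by-view i (view i)
  where
  by-view : ∀ i → View i → next (suc i) ≢ inject₁ i
  by-view _ ‵fromℕ e = 0≢1+n (trans (sym (next-fromℕ (suc (suc k)))) e)
  by-view _ (‵inject₁ j) e = suc²≢inject₁² j (trans (sym (next-inject₁ (suc j))) e)

next²≢id : ∀ {k} (i : Fin (suc (suc (suc k)))) → next (next i) ≢ i
next²≢id {k} i = by-view i (view i)
  where
  by-view : ∀ i → View i → next (next i) ≢ i
  by-view _ ‵fromℕ e =
    0≢1+n (suc-injective (trans (sym (cong next (next-fromℕ (suc (suc k))))) e))
  by-view _ (‵inject₁ j) e = next∘suc≢inject₁ j (trans (sym (cong next (next-inject₁ j))) e)

next²-prev² : ∀ {m} (i : Fin (suc m)) → next (next (prev (prev i))) ≡ i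
next²-prev² i = trans (cong next (next-prev (prev i))) (next-prev i)

prev≢next : ∀ {k} (i : Fin (suc (suc (suc k)))) → prev i ≢ next i
prev≢next i e = next²≢id i (trans (cong next (sym e)) (next-prev i))

prev²≢id : ∀ {k} (i : Fin (suc (suc (suc k)))) → prev (prev i) ≢ i
prev²≢id i e = next²≢id i (trans (cong (next ∘ next) (sym e)) (next²-prev² i))

twoValued-≢⇒≡ : ∀ {A : Set} {a b x y z : A} →
  x ≡ a ⊎ x ≡ b → y ≡ a ⊎ y ≡ b → z ≡ a ⊎ z ≡ b → x ≢ y → z ≢ y → x ≡ z
twoValued-≢⇒≡ (inj₁ refl) _           (inj₁ refl) _   _   = refl
twoValued-≢⇒≡ (inj₂ refl) _           (inj₂ refl) _   _   = refl
twoValued-≢⇒≡ (inj₁ refl) (inj₁ refl) (inj₂ refl) x≢y _   = contradiction refl x≢y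
twoValued-≢⇒≡ (inj₂ refl) (inj₂ refl) (inj₁ refl) x≢y _   = contradiction refl x≢y
twoValued-≢⇒≡ (inj₁ refl) (inj₂ refl) (inj₂ refl) _   z≢y = contradiction refl z≢y
twoValued-≢⇒≡ (inj₂ refl) (inj₁ refl) (inj₁ refl) _   z≢y = contradiction refl z≢y

edge⇒≢ : ∀ {G} (F : EdgeSet G) {x y} → mem F x y → x ≢ y
edge⇒≢ {G} F x~y refl = loopless G _ (sub F _ _ x~y)

module _ {G : Graph} {F : EdgeSet G} (C : Cycle G F) where

  edge-next : ∀ i → mem F (c C i) (c C (next i))
  edge-next i = by-view i (view i)
    where
    by-view : ∀ i → View i → mem F (c C i) (c C (next i))
    by-view _ ‵fromℕ =
      subst (mem F (c C (fromℕ (suc (suc (k C))))) ∘ c C) (sym (next-fromℕ _)) (close C)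
    by-view _ (‵inject₁ j) =
      subst (mem F (c C (inject₁ j)) ∘ c C) (sym (next-inject₁ j)) (edges C j)

  edge-prev : ∀ i → mem F (c C (prev i)) (c C i)
  edge-prev i = subst (mem F (c C (prev i)) ∘ c C) (next-prev i) (edge-next (prev i))

  twoColoured-alternates : (ψ : V G → ℕ) → (∀ x y → mem F x y → ψ x ≢ ψ y) →
    TwoColoured C ψ → ∀ i → ψ (c C (next (next i))) ≡ ψ (c C i)
  twoColoured-alternates ψ proper (_ , _ , _ , twoValued , _) i =
    twoValued-≢⇒≡ (twoValued _) (twoValued _) (twoValued _)
      (proper _ _ (symE F _ _ (edge-next (next i)))) (proper _ _ (edge-next i))

  twoColoured-cong : ∀ {φ ψ : V G → ℕ} → (∀ i → ψ (c C i) ≡ φ (c C i)) →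
    TwoColoured C ψ → TwoColoured C φ
  twoColoured-cong ψ≡φ (a , b , a≢b , twoValued , (i , ψi≡a) , (j , ψj≡b)) =
    a , b , a≢b , (λ i → map (transport i) (transport i) (twoValued i)) ,
    (i , transport i ψi≡a) , (j , transport j ψj≡b)
    where
    transport : ∀ i {x} → _ ≡ x → _ ≡ x
    transport i = trans (sym (ψ≡φ i))

  cycle-removeδ : ∀ {v} → (∀ i → c C i ≢ v) → Cycle G (removeδ G F v)
  cycle-removeδ avoids = record
    { k = k C ; c = c C ; inj = inj C
    ; edges = λ i → edges C i , avoids _ , avoids _
    ; close = close C , avoids _ , avoids _ }

module Recolouring {G : Graph} (φ : V G → ℕ) (v : V G) (col : ℕ) where

  ψ : V G → ℕ
  ψ = updateAt φ v (const col)

  ψ-v : ψ v ≡ col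
  ψ-v = updateAt-updates v φ

  ψ-≢ : ∀ {x} → x ≢ v → ψ x ≡ φ x
  ψ-≢ {x} = updateAt-minimal x v φ

  recolour-proper : (∀ x y → x ≢ v → y ≢ v → Adj G x y → φ x ≢ φ y) →
    (∀ x → Adj G v x → φ x ≢ col) → ∀ x y → Adj G x y → ψ x ≢ ψ y
  recolour-proper proper col∉φN x y x~y with x ≟ v | y ≟ v
  ... | yes refl | yes refl = contradiction x~y (loopless G v)
  ... | yes refl | no y≢v = λ e →
    col∉φN y x~y (trans (sym (ψ-≢ y≢v)) (trans (sym e) ψ-v))
  ... | no x≢v | yes refl = λ e →
    col∉φN x (Graph.sym G x v x~y) (trans (sym (ψ-≢ x≢v)) (trans e ψ-v))
  ... | no x≢v | no y≢v = λ e →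
    proper x y x≢v y≢v x~y (trans (sym (ψ-≢ x≢v)) (trans e (ψ-≢ y≢v)))

  recolour-lists : ∀ {L : V G → ℕ → Set} → L v col → (∀ x → x ≢ v → L x (φ x)) →
    ∀ x → L x (ψ x)
  recolour-lists {L} col∈Lv φ∈L x with x ≟ v
  ... | yes refl = subst (L v) (sym ψ-v) col∈Lv
  ... | no x≢v = subst (L x) (sym (ψ-≢ x≢v)) (φ∈L x x≢v)

  module _ (E₁ : EdgeSet G) (S : V G → Set)
    (S-hits-pairs : ∀ u₁ u₂ → u₁ ≢ u₂ → mem E₁ v u₁ → mem E₁ v u₂ → φ u₁ ≡ φ u₂ → S u₁ ⊎ S u₂)
    (col∉φNS : ∀ u x → S u → mem E₁ u x → x ≢ v → φ x ≢ col)
    (ψ-proper : ∀ x y → mem E₁ x y → ψ x ≢ ψ y)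
    where

    twoColoured-through-v : (C : Cycle G E₁) → ∀ j → c C j ≡ v → ¬ TwoColoured C ψ
    twoColoured-through-v C j cj≡v twoColoured =
      [ behind-blocked , ahead-blocked ]′
        (S-hits-pairs u₁ u₂ (prev≢next j ∘ inj C)
          (toV (symE E₁ _ _ (edge-prev C j))) (toV (edge-next C j)) φu₁≡φu₂)
      where
      open ≡-Reasoning
      alternates = twoColoured-alternates C ψ ψ-proper twoColoured
      u₁ = c C (prev j)
      u₂ = c C (next j)
      toV : ∀ {x} → mem E₁ (c C j) x → mem E₁ v x
      toV = subst (λ y → mem E₁ y _) cj≡v
      off-v : ∀ {x} → x ≢ c C j → x ≢ v
      off-v x≢cj x≡v = x≢cj (trans x≡v (sym cj≡v))
      ψ≡φ : ∀ {x} → x ≢ c C j → ψ x ≡ φ x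
      ψ≡φ = ψ-≢ ∘ off-v
      u₁≢cj = edge⇒≢ E₁ (edge-prev C j)
      u₂≢cj = ≢-sym (edge⇒≢ E₁ (edge-next C j))
      φu₁≡φu₂ : φ u₁ ≡ φ u₂
      φu₁≡φu₂ = begin
        φ u₁                              ≡⟨ sym (ψ≡φ u₁≢cj) ⟩
        ψ u₁                              ≡⟨ sym (alternates (prev j)) ⟩
        ψ (c C (next (next (prev j))))    ≡⟨ cong (ψ ∘ c C ∘ next) (next-prev j) ⟩
        ψ u₂                              ≡⟨ ψ≡φ u₂≢cj ⟩
        φ u₂                              ∎
      blocked : ∀ {u i} → S u → mem E₁ u (c C i) → i ≢ j → ψ (c C i) ≢ ψ (c C j)
      blocked {i = i} s u~ci i≢j ψci≡ψcj =
        col∉φNS _ _ s u~ci (off-v ci≢cj) (begin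
          φ (c C i) ≡⟨ sym (ψ≡φ ci≢cj) ⟩
          ψ (c C i) ≡⟨ ψci≡ψcj ⟩
          ψ (c C j) ≡⟨ cong ψ cj≡v ⟩
          ψ v       ≡⟨ ψ-v ⟩
          col       ∎)
        where ci≢cj = i≢j ∘ inj C
      behind-blocked : ¬ S u₁
      behind-blocked s = blocked s (symE E₁ _ _ (edge-prev C (prev j))) (prev²≢id j)
        (trans (sym (alternates (prev (prev j)))) (cong (ψ ∘ c C) (next²-prev² j)))
      ahead-blocked : ¬ S u₂
      ahead-blocked s = blocked s (edge-next C (next j)) (next²≢id j) (alternates j)

    recolour-acyclic :
      (∀ (C : Cycle G (removeδ G E₁ v)) → (∀ i → c C i ≢ v) → ¬ TwoColoured C φ) →
      ∀ (C : Cycle G E₁) → ¬ TwoColoured C ψ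
    recolour-acyclic φ-acyclic C twoColoured with any? (λ i → c C i ≟ v)
    ... | yes (j , cj≡v) = twoColoured-through-v C j cj≡v twoColoured
    ... | no v∉C = φ-acyclic (cycle-removeδ C avoids) avoids
      (twoColoured-cong C {φ} {ψ} (ψ-≢ ∘ avoids) twoColoured)
      where
      avoids : ∀ i → c C i ≢ v
      avoids i ci≡v = v∉C (i , ci≡v)

lemma3p7 : (G : Graph) (E₁ : EdgeSet G) (L : V G → ℕ → Set) (v : V G)
    (φ : V G → ℕ)
    → AcyclicLColouringOn G (λ x → x ≢ v) (removeδ G E₁ v) L φ
    → (S : V G → Set)
    → (∀ u → S u → mem E₁ v u)
    → (∀ u₁ u₂ → u₁ ≢ u₂ → mem E₁ v u₁ → mem E₁ v u₂ → φ u₁ ≡ φ u₂ → S u₁ ⊎ S u₂)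
    → (Σ ℕ λ col → L v col
         × (∀ x → Adj G v x → φ x ≢ col)
         × (∀ u x → S u → mem E₁ u x → x ≢ v → φ x ≢ col))
    → Σ (V G → ℕ) λ ψ → AcyclicLColouring G E₁ L ψ × (∀ x → x ≢ v → ψ x ≡ φ x)
lemma3p7 G E₁ L v φ (φ-proper , φ∈L , φ-acyclic) S _ S-hits-pairs
         (col , col∈Lv , col∉φN , col∉φNS) =
  ψ , ((λ x y _ _ → ψ-proper x y) , (λ x _ → recolour-lists col∈Lv φ∈L x) , (λ C _ → ψ-acyclic C))
    , λ _ → ψ-≢
  where
  open Recolouring φ v col
  ψ-proper : ∀ x y → Adj G x y → ψ x ≢ ψ y
  ψ-proper = recolour-proper φ-proper col∉φN
  ψ-acyclic : ∀ (C : Cycle G E₁) → ¬ TwoColoured C ψ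
  ψ-acyclic = recolour-acyclic E₁ S S-hits-pairs col∉φNS
    (λ x y → ψ-proper x y ∘ sub E₁ x y) φ-acyclic
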